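{- Let $\mathbf P=(P,\leq)$ be a poset, $a,b\in P$ with $a\leq b$, $x\in[a,b]$, and let $y$ be a complement of $x$. Assume that $e$ is the greatest element of $L\big(U(a,y),b\big)$ and $f$ is the smallest element of $U\big(a,L(y,b)\big)$. Then $a\leq f\leq e\leq b$, and the following are equivalent: (i) $e,f\in R(a,b,x)$; (ii) $(a,y,x)$ and $(x,y,b)$ are modular triples of $\mathbf P$.
   Context: In a poset $(P,\leq)$, for $A\subseteq P$ let $L(A)=\{p\in P\mid p\leq a\text{ for all }a\in A\}$ and $U(A)=\{p\in P\mid a\leq p\text{ for all }a\in A\}$. One writes $L(a)$ for $L(\{a\})$, $L(a,b)$ for $L(\{a,b\})$, $L(A,a)$ for $L(A\cup\{a\})$, $LU(A)$ for $L(U(A))$, and similarly for $U$. An element $y$ is a complement of $x$ if $LU(x,y)=UL(x,y)=P$. For $a\leq b$ and $x\in[a,b]$, an element $z\in[a,b]$ is a relative complement of $x$ in $[a,b]$ if $U(x,z)=U(b)$ and $L(x,z)=L(a)$; $R(a,b,x)$ denotes the set of all such relative complements. A triple $(p,q,r)$ of elements of $P$ is a modular triple of $\mathbf P$ if $p\leq r$ and $L\big(U(p,q),r\big)=LU\big(p,L(q,r)\big)$. -}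

module Defs where

open import Level using (Level; _⊔_; suc)
open import Data.Product using (_×_; _,_)
open import Data.Sum using (_⊎_)
open import Relation.Binary.Bundles using (Poset)

module PosetNotions {c ℓ₁ ℓ₂ : Level} (𝐏 : Poset c ℓ₁ ℓ₂) where
  open Poset 𝐏

  Subset : Set (suc (c ⊔ ℓ₁ ⊔ ℓ₂))
  Subset = Carrier → Set (c ⊔ ℓ₁ ⊔ ℓ₂)

  _≐_ : Subset → Subset → Set (c ⊔ ℓ₁ ⊔ ℓ₂)
  A ≐ B = (∀ p → A p → B p) × (∀ p → B p → A p)

  whole : Subset
  whole _ = Lift⊤
    where open import Data.Unit.Polymorphic using () renaming (⊤ to Lift⊤)

  sing : Carrier → Subset
  sing a p = Level.Lift (c ⊔ ℓ₁ ⊔ ℓ₂) (p ≈ a)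

  pair : Carrier → Carrier → Subset
  pair a b p = Level.Lift (c ⊔ ℓ₁ ⊔ ℓ₂) ((p ≈ a) ⊎ (p ≈ b))

  adj : Subset → Carrier → Subset
  adj A a p = A p ⊎ Level.Lift (c ⊔ ℓ₁ ⊔ ℓ₂) (p ≈ a)

  adjˡ : Carrier → Subset → Subset
  adjˡ a A p = Level.Lift (c ⊔ ℓ₁ ⊔ ℓ₂) (p ≈ a) ⊎ A p

  L : Subset → Subset
  L A p = ∀ a → A a → Level.Lift (c ⊔ ℓ₁ ⊔ ℓ₂) (p ≤ a)

  U : Subset → Subset
  U A p = ∀ a → A a → Level.Lift (c ⊔ ℓ₁ ⊔ ℓ₂) (a ≤ p)

  IsGreatest : Subset → Carrier → Set (c ⊔ ℓ₁ ⊔ ℓ₂)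
  IsGreatest A e = A e × (∀ s → A s → Level.Lift (c ⊔ ℓ₁ ⊔ ℓ₂) (s ≤ e))

  IsSmallest : Subset → Carrier → Set (c ⊔ ℓ₁ ⊔ ℓ₂)
  IsSmallest A f = A f × (∀ s → A s → Level.Lift (c ⊔ ℓ₁ ⊔ ℓ₂) (f ≤ s))

  IsComplement : Carrier → Carrier → Set (c ⊔ ℓ₁ ⊔ ℓ₂)
  IsComplement y x = (L (U (pair x y)) ≐ whole) × (U (L (pair x y)) ≐ whole)

  InR : Carrier → Carrier → Carrier → Carrier → Set (c ⊔ ℓ₁ ⊔ ℓ₂)
  InR a b x z = (a ≤ z) × (z ≤ b)
              × (U (pair x z) ≐ U (sing b)) × (L (pair x z) ≐ L (sing a))

  -- (p,q,r) is a modular triple: p ≤ r and L(U(p,q),r) = LU(p,L(q,r))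
  ModularTriple : Carrier → Carrier → Carrier → Set (c ⊔ ℓ₁ ⊔ ℓ₂)
  ModularTriple p q r = (p ≤ r) × (L (adj (U (pair p q)) r) ≐ L (U (adjˡ p (L (pair q r)))))

  open import Function.Bundles using (_⇔_)
  Theorem5Statement : Set (c ⊔ ℓ₁ ⊔ ℓ₂)
  Theorem5Statement =
    (a b x y e f : Carrier) →
    a ≤ b → a ≤ x → x ≤ b →
    IsComplement y x →
    IsGreatest (L (adj (U (pair a y)) b)) e →
    IsSmallest (U (adjˡ a (L (pair y b)))) f →
    ((a ≤ f) × (f ≤ e) × (e ≤ b))
    × ((InR a b x e × InR a b x f) ⇔ (ModularTriple a y x × ModularTriple x y b))

-- Write x ∧ z ≤ a for L(x,z) ⊆ L(a) and b ≤ x ∨ z for U(x,z) ⊆ U(b). For a ≤ z ≤ b,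
-- z ∈ R(a,b,x) says exactly x ∧ z ≤ a and b ≤ x ∨ z. The inequality f ≤ e reduces
-- (i) to the two conditions x ∧ e ≤ a and b ≤ x ∨ f. Half of each modular-triple
-- identity holds in every poset; the other half is equivalent to x ∧ e ≤ a, resp.
-- b ≤ x ∨ f, once one knows x ∧ y ≤ a and b ≤ x ∨ y, which is all that is used of
-- y being a complement of x.
module Submission where

open import Defs
open import Level using (Level; _⊔_; lift; lower)
open import Relation.Binary.Bundles using (Poset)
open import Data.Product using (_×_; _,_; proj₁; proj₂)
open import Data.Product.Function.NonDependent.Propositional using (_×-⇔_)
open import Data.Sum using (inj₁; inj₂)
open import Data.Unit.Polymorphic using (tt)
open import Function.Bundles using (_⇔_; mk⇔)
open import Function.Construct.Composition using (_⇔-∘_)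

module _ {c ℓ₁ ℓ₂ : Level} (𝐏 : Poset c ℓ₁ ℓ₂) where
  open Poset 𝐏
  open PosetNotions 𝐏

  _⊆_ : Subset → Subset → Set (c ⊔ ℓ₁ ⊔ ℓ₂)
  A ⊆ B = ∀ p → A p → B p

  _∧_≤_ : Carrier → Carrier → Carrier → Set (c ⊔ ℓ₂)
  x ∧ z ≤ a = ∀ p → p ≤ x → p ≤ z → p ≤ a

  _≤_∨_ : Carrier → Carrier → Carrier → Set (c ⊔ ℓ₂)
  b ≤ x ∨ z = ∀ q → x ≤ q → z ≤ q → b ≤ q

  module _ {x y : Carrier} where

    L-pair⁺ : ∀ {p} → p ≤ x → p ≤ y → L (pair x y) p
    L-pair⁺ p≤x p≤y _ (lift (inj₁ w≈x)) = lift (trans p≤x (reflexive (Eq.sym w≈x)))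
    L-pair⁺ p≤x p≤y _ (lift (inj₂ w≈y)) = lift (trans p≤y (reflexive (Eq.sym w≈y)))

    L-pair⁻ˡ : ∀ {p} → L (pair x y) p → p ≤ x
    L-pair⁻ˡ p∈L = lower (p∈L x (lift (inj₁ Eq.refl)))

    L-pair⁻ʳ : ∀ {p} → L (pair x y) p → p ≤ y
    L-pair⁻ʳ p∈L = lower (p∈L y (lift (inj₂ Eq.refl)))

    U-pair⁺ : ∀ {q} → x ≤ q → y ≤ q → U (pair x y) q
    U-pair⁺ x≤q y≤q _ (lift (inj₁ w≈x)) = lift (trans (reflexive w≈x) x≤q)
    U-pair⁺ x≤q y≤q _ (lift (inj₂ w≈y)) = lift (trans (reflexive w≈y) y≤q)

    U-pair⁻ˡ : ∀ {q} → U (pair x y) q → x ≤ q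
    U-pair⁻ˡ q∈U = lower (q∈U x (lift (inj₁ Eq.refl)))

    U-pair⁻ʳ : ∀ {q} → U (pair x y) q → y ≤ q
    U-pair⁻ʳ q∈U = lower (q∈U y (lift (inj₂ Eq.refl)))

  module _ {a : Carrier} where

    L-sing⁺ : ∀ {p} → p ≤ a → L (sing a) p
    L-sing⁺ p≤a _ (lift w≈a) = lift (trans p≤a (reflexive (Eq.sym w≈a)))

    L-sing⁻ : ∀ {p} → L (sing a) p → p ≤ a
    L-sing⁻ p∈L = lower (p∈L a (lift Eq.refl))

    U-sing⁺ : ∀ {q} → a ≤ q → U (sing a) q
    U-sing⁺ a≤q _ (lift w≈a) = lift (trans (reflexive w≈a) a≤q)

    U-sing⁻ : ∀ {q} → U (sing a) q → a ≤ q
    U-sing⁻ q∈U = lower (q∈U a (lift Eq.refl))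

  module _ {A : Subset} {r : Carrier} where

    L-adj⁺ : ∀ {p} → (∀ w → A w → p ≤ w) → p ≤ r → L (adj A r) p
    L-adj⁺ p≤A p≤r w (inj₁ w∈A)         = lift (p≤A w w∈A)
    L-adj⁺ p≤A p≤r w (inj₂ (lift w≈r)) = lift (trans p≤r (reflexive (Eq.sym w≈r)))

    L-adj⁻ˡ : ∀ {p} → L (adj A r) p → ∀ w → A w → p ≤ w
    L-adj⁻ˡ p∈L w w∈A = lower (p∈L w (inj₁ w∈A))

    L-adj⁻ʳ : ∀ {p} → L (adj A r) p → p ≤ r
    L-adj⁻ʳ p∈L = lower (p∈L r (inj₂ (lift Eq.refl)))

    U-adjˡ⁺ : ∀ {q} → r ≤ q → (∀ w → A w → w ≤ q) → U (adjˡ r A) q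
    U-adjˡ⁺ r≤q A≤q w (inj₁ (lift w≈r)) = lift (trans (reflexive w≈r) r≤q)
    U-adjˡ⁺ r≤q A≤q w (inj₂ w∈A)         = lift (A≤q w w∈A)

    U-adjˡ⁻ˡ : ∀ {q} → U (adjˡ r A) q → r ≤ q
    U-adjˡ⁻ˡ q∈U = lower (q∈U r (inj₁ (lift Eq.refl)))

    U-adjˡ⁻ʳ : ∀ {q} → U (adjˡ r A) q → ∀ w → A w → w ≤ q
    U-adjˡ⁻ʳ q∈U w w∈A = lower (q∈U w (inj₂ w∈A))

  complement⇒∧-least : ∀ {x y} → IsComplement y x → ∀ q → x ∧ y ≤ q
  complement⇒∧-least (_ , (_ , P⊆UL)) q p p≤x p≤y = lower (P⊆UL q tt p (L-pair⁺ p≤x p≤y))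

  complement⇒∨-greatest : ∀ {x y} → IsComplement y x → ∀ p → p ≤ x ∨ y
  complement⇒∨-greatest ((_ , P⊆LU) , _) p q x≤q y≤q = lower (P⊆LU p tt q (U-pair⁺ x≤q y≤q))

  ∧≤-antitone : ∀ {x z z′ a} → z′ ≤ z → x ∧ z ≤ a → x ∧ z′ ≤ a
  ∧≤-antitone z′≤z x∧z≤a p p≤x p≤z′ = x∧z≤a p p≤x (trans p≤z′ z′≤z)

  ≤∨-monotone : ∀ {x z z′ b} → z ≤ z′ → b ≤ x ∨ z → b ≤ x ∨ z′
  ≤∨-monotone z≤z′ b≤x∨z q x≤q z′≤q = b≤x∨z q x≤q (trans z≤z′ z′≤q)

  InR⁺ : ∀ {a b x z} → a ≤ x → x ≤ b → a ≤ z → z ≤ b →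
         x ∧ z ≤ a → b ≤ x ∨ z → InR a b x z
  InR⁺ a≤x x≤b a≤z z≤b x∧z≤a b≤x∨z =
    a≤z , z≤b ,
    ((λ q q∈U → U-sing⁺ (b≤x∨z q (U-pair⁻ˡ q∈U) (U-pair⁻ʳ q∈U))) ,
     (λ q q∈U → U-pair⁺ (trans x≤b (U-sing⁻ q∈U)) (trans z≤b (U-sing⁻ q∈U)))) ,
    ((λ p p∈L → L-sing⁺ (x∧z≤a p (L-pair⁻ˡ p∈L) (L-pair⁻ʳ p∈L))) ,
     (λ p p∈L → L-pair⁺ (trans (L-sing⁻ p∈L) a≤x) (trans (L-sing⁻ p∈L) a≤z)))

  InR⇒∧≤ : ∀ {a b x z} → InR a b x z → x ∧ z ≤ a
  InR⇒∧≤ (_ , _ , _ , (L⊆La , _)) p p≤x p≤z = L-sing⁻ (L⊆La p (L-pair⁺ p≤x p≤z))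

  InR⇒≤∨ : ∀ {a b x z} → InR a b x z → b ≤ x ∨ z
  InR⇒≤∨ (_ , _ , (U⊆Ub , _) , _) q x≤q z≤q = U-sing⁻ (U⊆Ub q (U-pair⁺ x≤q z≤q))

  LU-adjˡ-L⊆L-adj-U : ∀ {p q r} → p ≤ r →
                      L (U (adjˡ p (L (pair q r)))) ⊆ L (adj (U (pair p q)) r)
  LU-adjˡ-L⊆L-adj-U {p} {q} {r} p≤r s s∈LU = L-adj⁺ s≤U s≤r
    where
    s≤U : ∀ u → U (pair p q) u → s ≤ u
    s≤U u u∈U = lower (s∈LU u (U-adjˡ⁺ (U-pair⁻ˡ u∈U)
                                      (λ l l∈L → trans (L-pair⁻ˡ l∈L) (U-pair⁻ʳ u∈U))))
    s≤r : s ≤ r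
    s≤r = lower (s∈LU r (U-adjˡ⁺ p≤r (λ l l∈L → L-pair⁻ʳ l∈L)))

  ModularTriple⁺ : ∀ {p q r} → p ≤ r →
                   L (adj (U (pair p q)) r) ⊆ L (U (adjˡ p (L (pair q r)))) →
                   ModularTriple p q r
  ModularTriple⁺ p≤r ⊆LU = p≤r , (⊆LU , LU-adjˡ-L⊆L-adj-U p≤r)

  module Envelope {a b y e f : Carrier} (a≤b : a ≤ b)
           (e-greatest : IsGreatest (L (adj (U (pair a y)) b)) e)
           (f-smallest : IsSmallest (U (adjˡ a (L (pair y b)))) f) where

    private
      e∈ = proj₁ e-greatest
      f∈ = proj₁ f-smallest

      ≤e : ∀ {p} → L (adj (U (pair a y)) b) p → p ≤ e
      ≤e p∈ = lower (proj₂ e-greatest _ p∈)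

      f≤ : ∀ {q} → U (adjˡ a (L (pair y b))) q → f ≤ q
      f≤ q∈ = lower (proj₂ f-smallest _ q∈)

    a≤e : a ≤ e
    a≤e = ≤e (L-adj⁺ (λ u u∈U → U-pair⁻ˡ u∈U) a≤b)

    e≤b : e ≤ b
    e≤b = L-adj⁻ʳ e∈

    a≤f : a ≤ f
    a≤f = U-adjˡ⁻ˡ f∈

    f≤e : f ≤ e
    f≤e = f≤ (U-adjˡ⁺ a≤e (λ l l∈L →
            ≤e (L-adj⁺ (λ u u∈U → trans (L-pair⁻ˡ l∈L) (U-pair⁻ʳ u∈U)) (L-pair⁻ʳ l∈L))))

    relativeComplements⇔ : ∀ {x} → a ≤ x → x ≤ b →
                           (InR a b x e × InR a b x f) ⇔ (x ∧ e ≤ a × b ≤ x ∨ f)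
    relativeComplements⇔ a≤x x≤b = mk⇔
      (λ (e∈R , f∈R) → InR⇒∧≤ e∈R , InR⇒≤∨ f∈R)
      (λ (x∧e≤a , b≤x∨f) →
        InR⁺ a≤x x≤b a≤e e≤b x∧e≤a (≤∨-monotone f≤e b≤x∨f) ,
        InR⁺ a≤x x≤b a≤f (trans f≤e e≤b) (∧≤-antitone f≤e x∧e≤a) b≤x∨f)

    ∧≤⇔lowerModular : ∀ {x} → a ≤ x → x ≤ b → x ∧ y ≤ a →
                      x ∧ e ≤ a ⇔ ModularTriple a y x
    ∧≤⇔lowerModular a≤x x≤b x∧y≤a = mk⇔
      (λ x∧e≤a → ModularTriple⁺ a≤x λ p p∈L q q∈U →
        lift (trans (x∧e≤a p (L-adj⁻ʳ p∈L)
                               (≤e (L-adj⁺ (L-adj⁻ˡ p∈L) (trans (L-adj⁻ʳ p∈L) x≤b))))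
                    (U-adjˡ⁻ˡ q∈U)))
      (λ (_ , (⊆LU , _)) p p≤x p≤e →
        lower (⊆LU p (L-adj⁺ (λ u u∈U → trans p≤e (L-adj⁻ˡ e∈ u u∈U)) p≤x) a
          (U-adjˡ⁺ refl (λ l l∈L → x∧y≤a l (L-pair⁻ʳ l∈L) (L-pair⁻ˡ l∈L)))))

    ≤∨⇔upperModular : ∀ {x} → a ≤ x → x ≤ b → b ≤ x ∨ y →
                      b ≤ x ∨ f ⇔ ModularTriple x y b
    ≤∨⇔upperModular a≤x x≤b b≤x∨y = mk⇔
      (λ b≤x∨f → ModularTriple⁺ x≤b λ p p∈L q q∈U →
        lift (trans (L-adj⁻ʳ p∈L)
                    (b≤x∨f q (U-adjˡ⁻ˡ q∈U)
                           (f≤ (U-adjˡ⁺ (trans a≤x (U-adjˡ⁻ˡ q∈U)) (U-adjˡ⁻ʳ q∈U))))))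
      (λ (_ , (⊆LU , _)) q x≤q f≤q →
        lower (⊆LU b (L-adj⁺ (λ u u∈U → b≤x∨y u (U-pair⁻ˡ u∈U) (U-pair⁻ʳ u∈U)) refl) q
          (U-adjˡ⁺ x≤q (λ l l∈L → trans (U-adjˡ⁻ʳ f∈ l l∈L) f≤q))))

theorem5 : ∀ {c ℓ₁ ℓ₂ : Level} (𝐏 : Poset c ℓ₁ ℓ₂) →
    PosetNotions.Theorem5Statement 𝐏
theorem5 𝐏 a b x y e f a≤b a≤x x≤b y-complement e-greatest f-smallest =
  (a≤f , f≤e , e≤b) ,
  (∧≤⇔lowerModular a≤x x≤b (complement⇒∧-least 𝐏 y-complement a)
    ×-⇔ ≤∨⇔upperModular a≤x x≤b (complement⇒∨-greatest 𝐏 y-complement b))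
  ⇔-∘ relativeComplements⇔ a≤x x≤b
  where open Envelope 𝐏 a≤b e-greatest f-smallest
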